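{- For every positive integer $n$, the maximum number of entries equal to $-1$ in an $n\times n$ alternating sign matrix equals the maximum number of entries equal to $-1$ in an $n\times n$ magog matrix, and both equal $\lfloor\frac{n-1}{2}\rfloor\lceil\frac{n-1}{2}\rceil$.
   Context: An alternating sign matrix (ASM) is a square matrix with entries in $\{0,1,-1\}$ in which every row and column sums to $1$ and the nonzero entries of each row and each column alternate in sign. An $n\times n$ magog matrix is an $n\times n$ matrix $A=(a_{ij})$ with entries in $\{0,1,-1\}$ such that all row sums and all column sums equal $1$, $0\le \sum_{i'=1}^{i}a_{i'j}\le 1$ for all $1\le i,j\le n$, $\sum_{j'=1}^{j}a_{ij'}\ge 0$ for all $1\le i,j\le n$, and for all $1\le i\le n-2$, $1\le j\le n-2$, $$\sum_{j'=1}^{j}a_{i+1,j'}+\sum_{i'=1}^{i+1}a_{i',j+1}-\sum_{i'=1}^{i}a_{i'j}\ge 0.$$ -}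

module Defs where

open import Data.Nat as ℕ using (ℕ; zero; suc; _∸_; _<_; _≤_; _<?_)
open import Data.Fin using (Fin; fromℕ<)
open import Data.Integer as ℤ using (ℤ; +_; -_; _+_; _-_; _≥_)
open import Data.Bool using (true; false)
open import Data.Sum using (_⊎_)
open import Data.Product using (Σ; _×_)
open import Relation.Nullary using (yes; no; does)
open import Relation.Binary.PropositionalEquality using (_≡_; _≢_)

Matrix : ℕ → Set
Matrix n = Fin n → Fin n → ℤ

-- 1-based entry access a_{ij} (i, j ∈ {1,…,n}); 0 outside the matrix
-- (only ever used for 1 ≤ i, j ≤ n).
entry : ∀ {n} → Matrix n → ℕ → ℕ → ℤ
entry {n} A zero _ = + 0
entry {n} A (suc i) zero = + 0
entry {n} A (suc i) (suc j) with i <? n | j <? n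
... | yes p | yes q = A (fromℕ< p) (fromℕ< q)
... | _ | _ = + 0

sum1to : ℕ → (ℕ → ℤ) → ℤ
sum1to zero f = + 0
sum1to (suc m) f = sum1to m f + f (suc m)

sumℕ1to : ℕ → (ℕ → ℕ) → ℕ
sumℕ1to zero f = 0
sumℕ1to (suc m) f = sumℕ1to m f ℕ.+ f (suc m)

Entries01-1 : ∀ {n} → Matrix n → Set
Entries01-1 A = ∀ i j → (A i j ≡ + 0) ⊎ (A i j ≡ + 1) ⊎ (A i j ≡ - + 1)

RowSumsOne : ∀ {n} → Matrix n → Set
RowSumsOne {n} A = ∀ i → 1 ≤ i → i ≤ n → sum1to n (λ j → entry A i j) ≡ + 1

ColSumsOne : ∀ {n} → Matrix n → Set
ColSumsOne {n} A = ∀ j → 1 ≤ j → j ≤ n → sum1to n (λ i → entry A i j) ≡ + 1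

RowsAlternate : ∀ {n} → Matrix n → Set
RowsAlternate {n} A =
  ∀ i j k → 1 ≤ i → i ≤ n → 1 ≤ j → j < k → k ≤ n →
  entry A i j ≢ + 0 → entry A i k ≢ + 0 →
  (∀ l → j < l → l < k → entry A i l ≡ + 0) →
  entry A i j ≡ - entry A i k

ColsAlternate : ∀ {n} → Matrix n → Set
ColsAlternate {n} A =
  ∀ j i k → 1 ≤ j → j ≤ n → 1 ≤ i → i < k → k ≤ n →
  entry A i j ≢ + 0 → entry A k j ≢ + 0 →
  (∀ l → i < l → l < k → entry A l j ≡ + 0) →
  entry A i j ≡ - entry A k j

IsASM : ∀ {n} → Matrix n → Set
IsASM A = Entries01-1 A × RowSumsOne A × ColSumsOne A × RowsAlternate A × ColsAlternate A

IsMagog : ∀ {n} → Matrix n → Set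
IsMagog {n} A =
  Entries01-1 A × RowSumsOne A × ColSumsOne A ×
  (∀ i j → 1 ≤ i → i ≤ n → 1 ≤ j → j ≤ n →
     (sum1to i (λ i' → entry A i' j) ≥ + 0) × (+ 1 ≥ sum1to i (λ i' → entry A i' j))) ×
  (∀ i j → 1 ≤ i → i ≤ n → 1 ≤ j → j ≤ n →
     sum1to j (λ j' → entry A i j') ≥ + 0) ×
  (∀ i j → 1 ≤ i → i ≤ n ∸ 2 → 1 ≤ j → j ≤ n ∸ 2 →
     (sum1to j (λ j' → entry A (suc i) j')
       + sum1to (suc i) (λ i' → entry A i' (suc j))
       - sum1to i (λ i' → entry A i' j)) ≥ + 0)

isMinusOne : ℤ → ℕ
isMinusOne x with does (x ℤ.≟ - + 1)
... | true = 1
... | false = 0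

negCount : ∀ {n} → Matrix n → ℕ
negCount {n} A = sumℕ1to n (λ i → sumℕ1to n (λ j → isMinusOne (entry A i j)))

IsMaxNegCount : (n : ℕ) → (Matrix n → Set) → ℕ → Set
IsMaxNegCount n P m =
  Σ (Matrix n) (λ A → P A × negCount A ≡ m) × (∀ (A : Matrix n) → P A → negCount A ≤ m)

-- Write S(i, j) = a_{1j} + ⋯ + a_{ij} for the column partial sums. They lie in {0, 1}: for a
-- magog by definition, and for an ASM because the nonzero entries of a column alternate and
-- add up to 1, hence start with 1. An entry -1 at (i, j) forces S(i - 1, j) = 1 and S(i, j) = 0,
-- while S(i, 1) + ⋯ + S(i, n) = i for every i; so row i has at most min(i - 1, n - i) entries
-- -1, and these bounds add up to ⌊(n-1)/2⌋⌈(n-1)/2⌉.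
-- One symmetric matrix attains the bound and is both an ASM and a magog. With Q = ⌊(n-1)/2⌋,
-- its row i (counted from 0) is 0 ⋯ 0 1 -1 1 ⋯ -1 1 0 ⋯ 0, starting in column |Q - i| and
-- containing min(i, n-1-i) entries -1. Its nonzero entries fill a diamond, on which the sign of
-- entry (i, j) is (-1)^(i+j+Q); this makes the matrix symmetric, so column partial sums are
-- row prefix sums, which lie in {0, 1}. The magog inequality comes down to this: if a prefix of
-- row i sums to 1, so does the prefix of row i + 1 that is one entry longer.
{-# OPTIONS --safe #-}
module Submission where

open import Defs
open import Data.Nat
  using (ℕ; zero; suc; _+_; _*_; _∸_; _⊓_; ∣_-_∣; ⌊_/2⌋; ⌈_/2⌉; _≤_; _<_; _≤?_; _<?_; z≤n; s≤s; s≤s⁻¹)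
import Data.Nat.Properties as ℕ
open import Data.Integer as ℤ using (ℤ; +_; -_; -[1+_]; +≤+)
import Data.Integer.Properties as ℤ
open import Data.Nat.Tactic.RingSolver using () renaming (solve-∀ to ℕ-solve-∀)
open import Data.Integer.Tactic.RingSolver using () renaming (solve-∀ to ℤ-solve-∀)
open import Data.Fin using (toℕ)
open import Data.Fin.Properties using (toℕ-fromℕ<)
open import Data.Sum using (_⊎_; inj₁; inj₂)
open import Data.Product using (_×_; ∃; _,_; proj₁; proj₂)
open import Data.Empty using (⊥-elim)
open import Function using (_∘_)
open import Relation.Nullary using (¬_; Dec; yes; no)
open import Relation.Nullary.Decidable using (_×-dec_)
open import Relation.Binary.PropositionalEquality

sumℤ< : ℕ → (ℕ → ℤ) → ℤ
sumℤ< zero    f = + 0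
sumℤ< (suc k) f = sumℤ< k f ℤ.+ f k

sumℕ< : ℕ → (ℕ → ℕ) → ℕ
sumℕ< zero    f = 0
sumℕ< (suc k) f = sumℕ< k f + f k

sum1to≡sumℤ< : ∀ m f → sum1to m f ≡ sumℤ< m (f ∘ suc)
sum1to≡sumℤ< zero    f = refl
sum1to≡sumℤ< (suc m) f = cong (ℤ._+ f (suc m)) (sum1to≡sumℤ< m f)

sumℕ1to≡sumℕ< : ∀ m f → sumℕ1to m f ≡ sumℕ< m (f ∘ suc)
sumℕ1to≡sumℕ< zero    f = refl
sumℕ1to≡sumℕ< (suc m) f = cong (_+ f (suc m)) (sumℕ1to≡sumℕ< m f)

sumℤ<-head : ∀ k f → sumℤ< (suc k) f ≡ f 0 ℤ.+ sumℤ< k (f ∘ suc)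
sumℤ<-head zero    f = ℤ.+-comm (+ 0) (f 0)
sumℤ<-head (suc k) f = trans (cong (ℤ._+ f (suc k)) (sumℤ<-head k f)) (ℤ.+-assoc (f 0) _ _)

sumℕ<-head : ∀ k f → sumℕ< (suc k) f ≡ f 0 + sumℕ< k (f ∘ suc)
sumℕ<-head zero    f = ℕ.+-comm 0 (f 0)
sumℕ<-head (suc k) f = trans (cong (_+ f (suc k)) (sumℕ<-head k f)) (ℕ.+-assoc (f 0) _ _)

sumℤ<-cong : ∀ k f g → (∀ x → x < k → f x ≡ g x) → sumℤ< k f ≡ sumℤ< k g
sumℤ<-cong zero    f g e = refl
sumℤ<-cong (suc k) f g e =
  cong₂ ℤ._+_ (sumℤ<-cong k f g (λ x x<k → e x (ℕ.m<n⇒m<1+n x<k))) (e k ℕ.≤-refl)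

sumℕ<-cong : ∀ k f g → (∀ x → x < k → f x ≡ g x) → sumℕ< k f ≡ sumℕ< k g
sumℕ<-cong zero    f g e = refl
sumℕ<-cong (suc k) f g e =
  cong₂ _+_ (sumℕ<-cong k f g (λ x x<k → e x (ℕ.m<n⇒m<1+n x<k))) (e k ℕ.≤-refl)

sumℤ<-zero : ∀ k → sumℤ< k (λ _ → + 0) ≡ + 0
sumℤ<-zero zero    = refl
sumℤ<-zero (suc k) = cong (ℤ._+ + 0) (sumℤ<-zero k)

sumℕ<-zero : ∀ k → sumℕ< k (λ _ → 0) ≡ 0
sumℕ<-zero zero    = refl
sumℕ<-zero (suc k) = cong (_+ 0) (sumℕ<-zero k)

sumℕ<-suc : ∀ k f → sumℕ< k (suc ∘ f) ≡ sumℕ< k f + k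
sumℕ<-suc zero    f = refl
sumℕ<-suc (suc k) f = begin
  sumℕ< k (suc ∘ f) + suc (f k) ≡⟨ cong (_+ suc (f k)) (sumℕ<-suc k f) ⟩
  sumℕ< k f + k + suc (f k)     ≡⟨ swap (sumℕ< k f) k (f k) ⟩
  sumℕ< k f + f k + suc k       ∎
  where
    open ≡-Reasoning
    swap : ∀ a b c → a + b + suc c ≡ a + c + suc b
    swap = ℕ-solve-∀

sum1to-cong : ∀ m f g → (∀ k → 1 ≤ k → k ≤ m → f k ≡ g k) → sum1to m f ≡ sum1to m g
sum1to-cong zero    f g e = refl
sum1to-cong (suc m) f g e =
  cong₂ ℤ._+_ (sum1to-cong m f g (λ k 1≤k k≤m → e k 1≤k (ℕ.m≤n⇒m≤1+n k≤m))) (e (suc m) (s≤s z≤n) ℕ.≤-refl)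

sum1to-mono-≤ : ∀ m f g → (∀ k → 1 ≤ k → k ≤ m → f k ℤ.≤ g k) → sum1to m f ℤ.≤ sum1to m g
sum1to-mono-≤ zero    f g e = +≤+ z≤n
sum1to-mono-≤ (suc m) f g e =
  ℤ.+-mono-≤ (sum1to-mono-≤ m f g (λ k 1≤k k≤m → e k 1≤k (ℕ.m≤n⇒m≤1+n k≤m))) (e (suc m) (s≤s z≤n) ℕ.≤-refl)

sumℕ1to-mono-≤ : ∀ m f g → (∀ k → 1 ≤ k → k ≤ m → f k ≤ g k) → sumℕ1to m f ≤ sumℕ1to m g
sumℕ1to-mono-≤ zero    f g e = z≤n
sumℕ1to-mono-≤ (suc m) f g e =
  ℕ.+-mono-≤ (sumℕ1to-mono-≤ m f g (λ k 1≤k k≤m → e k 1≤k (ℕ.m≤n⇒m≤1+n k≤m))) (e (suc m) (s≤s z≤n) ℕ.≤-refl)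

sum1to-+ : ∀ m f g → sum1to m (λ k → f k ℤ.+ g k) ≡ sum1to m f ℤ.+ sum1to m g
sum1to-+ zero    f g = refl
sum1to-+ (suc m) f g =
  trans (cong (ℤ._+ (f (suc m) ℤ.+ g (suc m))) (sum1to-+ m f g))
        (interchange (sum1to m f) (sum1to m g) (f (suc m)) (g (suc m)))
  where
    interchange : ∀ a b c d → (a ℤ.+ b) ℤ.+ (c ℤ.+ d) ≡ (a ℤ.+ c) ℤ.+ (b ℤ.+ d)
    interchange = ℤ-solve-∀

sum1to-neg : ∀ m f → sum1to m (λ k → - f k) ≡ - sum1to m f
sum1to-neg zero    f = refl
sum1to-neg (suc m) f =
  trans (cong (ℤ._+ (- f (suc m))) (sum1to-neg m f)) (sym (ℤ.neg-distrib-+ (sum1to m f) (f (suc m))))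

sum1to-ones : ∀ m → sum1to m (λ _ → + 1) ≡ + m
sum1to-ones zero    = refl
sum1to-ones (suc m) =
  trans (cong (ℤ._+ + 1) (sum1to-ones m)) (trans (sym (ℤ.pos-+ m 1)) (cong +_ (ℕ.+-comm m 1)))

sum1to-comm : ∀ m k (g : ℕ → ℕ → ℤ) →
              sum1to m (λ i → sum1to k (g i)) ≡ sum1to k (λ j → sum1to m (λ i → g i j))
sum1to-comm zero    k g = sym (trans (sum1to≡sumℤ< k _) (sumℤ<-zero k))
sum1to-comm (suc m) k g =
  trans (cong (ℤ._+ sum1to k (g (suc m))) (sum1to-comm m k g))
        (sym (sum1to-+ k (λ j → sum1to m (λ i → g i j)) (g (suc m))))

pos-sumℕ1to : ∀ m f → + sumℕ1to m f ≡ sum1to m (+_ ∘ f)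
pos-sumℕ1to zero    f = refl
pos-sumℕ1to (suc m) f = trans (ℤ.pos-+ (sumℕ1to m f) (f (suc m))) (cong (ℤ._+ + f (suc m)) (pos-sumℕ1to m f))

IsTrit : ℤ → Set
IsTrit x = x ≡ + 0 ⊎ x ≡ + 1 ⊎ x ≡ - + 1

IsBit : ℤ → Set
IsBit x = x ≡ + 0 ⊎ x ≡ + 1

bit-between : ∀ {x} → + 0 ℤ.≤ x → x ℤ.≤ + 1 → IsBit x
bit-between {+ 0}           _ _                = inj₁ refl
bit-between {+ 1}           _ _                = inj₂ refl
bit-between {+ suc (suc _)} _ (+≤+ (s≤s ()))
bit-between { -[1+ _ ]}     () _

0≤bit : ∀ {x} → IsBit x → + 0 ℤ.≤ x
0≤bit (inj₁ refl) = +≤+ z≤n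
0≤bit (inj₂ refl) = +≤+ z≤n

bit≤1 : ∀ {x} → IsBit x → x ℤ.≤ + 1
bit≤1 (inj₁ refl) = +≤+ z≤n
bit≤1 (inj₂ refl) = +≤+ (s≤s z≤n)

isMinusOne≤bitAbove : ∀ {x y} → IsBit x → IsTrit y → + 0 ℤ.≤ x ℤ.+ y → + isMinusOne y ℤ.≤ x
isMinusOne≤bitAbove (inj₁ refl) (inj₁ refl)        _  = +≤+ z≤n
isMinusOne≤bitAbove (inj₁ refl) (inj₂ (inj₁ refl)) _  = +≤+ z≤n
isMinusOne≤bitAbove (inj₁ refl) (inj₂ (inj₂ refl)) ()
isMinusOne≤bitAbove (inj₂ refl) (inj₁ refl)        _  = +≤+ z≤n
isMinusOne≤bitAbove (inj₂ refl) (inj₂ (inj₁ refl)) _  = +≤+ z≤n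
isMinusOne≤bitAbove (inj₂ refl) (inj₂ (inj₂ refl)) _  = +≤+ (s≤s z≤n)

isMinusOne≤1-bitHere : ∀ {x y} → IsBit x → IsTrit y → x ℤ.+ y ℤ.≤ + 1 →
                       + isMinusOne y ℤ.≤ + 1 ℤ.- (x ℤ.+ y)
isMinusOne≤1-bitHere (inj₁ refl) (inj₁ refl)        _                = +≤+ z≤n
isMinusOne≤1-bitHere (inj₁ refl) (inj₂ (inj₁ refl)) _                = +≤+ z≤n
isMinusOne≤1-bitHere (inj₁ refl) (inj₂ (inj₂ refl)) _                = +≤+ (s≤s z≤n)
isMinusOne≤1-bitHere (inj₂ refl) (inj₁ refl)        _                = +≤+ z≤n
isMinusOne≤1-bitHere (inj₂ refl) (inj₂ (inj₁ refl)) (+≤+ (s≤s ()))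
isMinusOne≤1-bitHere (inj₂ refl) (inj₂ (inj₂ refl)) _                = +≤+ (s≤s z≤n)

magogCombination≥0 : ∀ {a b c} → IsBit a → IsBit b → IsBit c → (c ≡ + 1 → b ≡ + 1) → a ℤ.+ b ℤ.- c ℤ.≥ + 0
magogCombination≥0 (inj₁ refl) (inj₁ refl) (inj₁ refl) _ = +≤+ z≤n
magogCombination≥0 (inj₁ refl) (inj₂ refl) (inj₁ refl) _ = +≤+ z≤n
magogCombination≥0 (inj₂ refl) (inj₁ refl) (inj₁ refl) _ = +≤+ z≤n
magogCombination≥0 (inj₂ refl) (inj₂ refl) (inj₁ refl) _ = +≤+ z≤n
magogCombination≥0 _           (inj₁ refl) (inj₂ refl) c⇒b with c⇒b refl
... | ()
magogCombination≥0 (inj₁ refl) (inj₂ refl) (inj₂ refl) _ = +≤+ z≤n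
magogCombination≥0 (inj₂ refl) (inj₂ refl) (inj₂ refl) _ = +≤+ z≤n

-- The upper bound

colPartialSum : ∀ {n} → Matrix n → ℕ → ℕ → ℤ
colPartialSum A i j = sum1to i (λ i′ → entry A i′ j)

minusOnesInRow : ∀ {n} → Matrix n → ℕ → ℕ
minusOnesInRow {n} A i = sumℕ1to n (λ j → isMinusOne (entry A i j))

ColPartialSumsIn01 : ∀ {n} → Matrix n → Set
ColPartialSumsIn01 {n} A =
  ∀ i j → 1 ≤ i → i ≤ n → 1 ≤ j → j ≤ n →
    (sum1to i (λ i′ → entry A i′ j) ℤ.≥ + 0) × (+ 1 ℤ.≥ sum1to i (λ i′ → entry A i′ j))

IsBitPrefixMatrix : ∀ {n} → Matrix n → Set
IsBitPrefixMatrix A = Entries01-1 A × ColPartialSumsIn01 A × RowSumsOne A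

magog⇒bitPrefixMatrix : ∀ {n} {A : Matrix n} → IsMagog A → IsBitPrefixMatrix A
magog⇒bitPrefixMatrix (entries , rowSums , _ , colPrefixes , _) = entries , colPrefixes , rowSums

entry-trit : ∀ {n} {A : Matrix n} → Entries01-1 A → ∀ i j → IsTrit (entry A i j)
entry-trit {n} {A} entries zero    j       = inj₁ refl
entry-trit {n} {A} entries (suc i) zero    = inj₁ refl
entry-trit {n} {A} entries (suc i) (suc j) with i <? n | j <? n
... | yes _ | yes _ = entries _ _
... | yes _ | no _  = inj₁ refl
... | no _  | _     = inj₁ refl

module _ {n} {A : Matrix n} (entries : Entries01-1 A) (colPrefixes : ColPartialSumsIn01 A)
         (rowSums : RowSumsOne A) where

  colPartialSum-bit : ∀ i j → i ≤ n → 1 ≤ j → j ≤ n → IsBit (colPartialSum A i j)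
  colPartialSum-bit zero    j _   _   _   = inj₁ refl
  colPartialSum-bit (suc i) j i<n 1≤j j≤n =
    let (0≤s , s≤1) = colPrefixes (suc i) j (s≤s z≤n) i<n 1≤j j≤n in bit-between 0≤s s≤1

  sum-colPartialSum : ∀ i → i ≤ n → sum1to n (colPartialSum A i) ≡ + i
  sum-colPartialSum i i≤n = begin
    sum1to n (colPartialSum A i)                       ≡⟨ sum1to-comm i n (entry A) ⟨
    sum1to i (λ i′ → sum1to n (entry A i′))            ≡⟨ sum1to-cong i _ _ rowSum ⟩
    sum1to i (λ _ → + 1)                               ≡⟨ sum1to-ones i ⟩
    + i                                                ∎
    where
      open ≡-Reasoning
      rowSum : ∀ k → 1 ≤ k → k ≤ i → sum1to n (entry A k) ≡ + 1
      rowSum k 1≤k k≤i = rowSums k 1≤k (ℕ.≤-trans k≤i i≤n)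

  -- A -1 at (i+1, j) needs a 1 just above it in the column partial sums and
  -- leaves a 0 there in row i+1; the partial sums of row i add up to i.
  minusOnesInRow≤above : ∀ i → suc i ≤ n → minusOnesInRow A (suc i) ≤ i
  minusOnesInRow≤above i i<n = ℤ.drop‿+≤+ (begin
    + minusOnesInRow A (suc i)                                  ≡⟨ pos-sumℕ1to n _ ⟩
    sum1to n (λ j → + isMinusOne (entry A (suc i) j))           ≤⟨ sum1to-mono-≤ n _ _ pointwise ⟩
    sum1to n (colPartialSum A i)                                ≡⟨ sum-colPartialSum i (ℕ.<⇒≤ i<n) ⟩
    + i                                                         ∎)
    where
      open ℤ.≤-Reasoning
      pointwise : ∀ j → 1 ≤ j → j ≤ n → + isMinusOne (entry A (suc i) j) ℤ.≤ colPartialSum A i j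
      pointwise j 1≤j j≤n =
        isMinusOne≤bitAbove (colPartialSum-bit i j (ℕ.<⇒≤ i<n) 1≤j j≤n) (entry-trit entries (suc i) j)
                            (proj₁ (colPrefixes (suc i) j (s≤s z≤n) i<n 1≤j j≤n))

  minusOnesInRow≤below : ∀ i → suc i ≤ n → minusOnesInRow A (suc i) ≤ n ∸ suc i
  minusOnesInRow≤below i i<n = ℤ.drop‿+≤+ (begin
    + minusOnesInRow A (suc i)                                  ≡⟨ pos-sumℕ1to n _ ⟩
    sum1to n (λ j → + isMinusOne (entry A (suc i) j))           ≤⟨ sum1to-mono-≤ n _ _ pointwise ⟩
    sum1to n (λ j → + 1 ℤ.- colPartialSum A (suc i) j)          ≡⟨ sum1to-+ n _ _ ⟩
    sum1to n (λ _ → + 1) ℤ.+ sum1to n (λ j → ℤ.- colPartialSum A (suc i) j)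
                                                 ≡⟨ cong₂ ℤ._+_ (sum1to-ones n) (sum1to-neg n _) ⟩
    + n ℤ.- sum1to n (colPartialSum A (suc i))  ≡⟨ cong (λ s → + n ℤ.- s) (sum-colPartialSum (suc i) i<n) ⟩
    + n ℤ.- + suc i                                             ≡⟨ ℤ.m-n≡m⊖n n (suc i) ⟩
    n ℤ.⊖ suc i                                                 ≡⟨ ℤ.⊖-≥ i<n ⟩
    + (n ∸ suc i)                                               ∎)
    where
      open ℤ.≤-Reasoning
      pointwise : ∀ j → 1 ≤ j → j ≤ n →
                  + isMinusOne (entry A (suc i) j) ℤ.≤ + 1 ℤ.- colPartialSum A (suc i) j
      pointwise j 1≤j j≤n =
        isMinusOne≤1-bitHere (colPartialSum-bit i j (ℕ.<⇒≤ i<n) 1≤j j≤n) (entry-trit entries (suc i) j)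
                             (proj₂ (colPrefixes (suc i) j (s≤s z≤n) i<n 1≤j j≤n))

  negCount≤ : negCount A ≤ sumℕ1to n (λ i → (i ∸ 1) ⊓ (n ∸ i))
  negCount≤ = sumℕ1to-mono-≤ n _ _ row
    where
      row : ∀ i → 1 ≤ i → i ≤ n → minusOnesInRow A i ≤ (i ∸ 1) ⊓ (n ∸ i)
      row (suc i) _ i<n = ℕ.⊓-glb (minusOnesInRow≤above i i<n) (minusOnesInRow≤below i i<n)

-- Column partial sums of an alternating sign matrix

module _ {n} {A : Matrix n} (colsAlternate : ColsAlternate A) (colSums : ColSumsOne A)
         {j} (1≤j : 1 ≤ j) (j≤n : j ≤ n) where

  private
    x : ℕ → ℤ
    x i = entry A i j

    S : ℕ → ℤ
    S i = colPartialSum A i j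

  ZeroUpTo : ℕ → Set
  ZeroUpTo i = ∀ l → 1 ≤ l → l ≤ i → x l ≡ + 0

  LastNonzeroUpTo : ℕ → ℤ → Set
  LastNonzeroUpTo i σ = ∃ λ k → 1 ≤ k × k ≤ i × x k ≡ σ × (∀ l → k < l → l ≤ i → x l ≡ + 0)

  -- The nonzero entries seen so far alternate starting with σ, so the partial
  -- sum is σ or 0 according to the sign of the last of them.
  data Signed (σ : ℤ) (i : ℕ) : Set where
    raised  : S i ≡ σ   → LastNonzeroUpTo i σ     → Signed σ i
    lowered : S i ≡ + 0 → LastNonzeroUpTo i (- σ) → Signed σ i

  zeroUpTo-suc : ∀ {i} → ZeroUpTo i → x (suc i) ≡ + 0 → ZeroUpTo (suc i)
  zeroUpTo-suc {i} zeros x≡0 l 1≤l l≤1+i with ℕ.m≤n⇒m<n∨m≡n l≤1+i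
  ... | inj₁ l≤i = zeros l 1≤l (s≤s⁻¹ l≤i)
  ... | inj₂ refl = x≡0

  lastNonzero-suc : ∀ {i σ} → LastNonzeroUpTo i σ → x (suc i) ≡ + 0 → LastNonzeroUpTo (suc i) σ
  lastNonzero-suc {i} (k , 1≤k , k≤i , xk , after) x≡0 = k , 1≤k , ℕ.m≤n⇒m≤1+n k≤i , xk , after′
    where
      after′ : ∀ l → k < l → l ≤ suc i → x l ≡ + 0
      after′ l k<l l≤1+i with ℕ.m≤n⇒m<n∨m≡n l≤1+i
      ... | inj₁ l≤i = after l k<l (s≤s⁻¹ l≤i)
      ... | inj₂ refl = x≡0

  lastNonzero-here : ∀ {i σ} → x (suc i) ≡ σ → LastNonzeroUpTo (suc i) σ
  lastNonzero-here {i} x≡σ = suc i , s≤s z≤n , ℕ.≤-refl , x≡σ , λ l i<l l≤i → ⊥-elim (ℕ.<⇒≱ i<l l≤i)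

  next-nonzero : ∀ {i σ} → σ ≢ + 0 → suc i ≤ n → LastNonzeroUpTo i σ → x (suc i) ≢ + 0 →
                 x (suc i) ≡ - σ
  next-nonzero {i} {σ} σ≢0 i<n (k , 1≤k , k≤i , xk , after) x≢0 = begin
    x (suc i)     ≡⟨ ℤ.neg-involutive (x (suc i)) ⟨
    - - x (suc i) ≡⟨ cong -_ alternation ⟨
    - x k         ≡⟨ cong -_ xk ⟩
    - σ           ∎
    where
      open ≡-Reasoning
      alternation : x k ≡ - x (suc i)
      alternation = colsAlternate j k (suc i) 1≤j j≤n 1≤k (s≤s k≤i) i<n
                      (λ xk≡0 → σ≢0 (trans (sym xk) xk≡0)) x≢0 (λ l k<l l≤i → after l k<l (s≤s⁻¹ l≤i))

  neg-≢0 : ∀ {σ} → σ ≢ + 0 → - σ ≢ + 0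
  neg-≢0 {σ} σ≢0 -σ≡0 = σ≢0 (trans (sym (ℤ.neg-involutive σ)) (cong -_ -σ≡0))

  signed-suc : ∀ {i σ} → σ ≢ + 0 → suc i ≤ n → Signed σ i → Signed σ (suc i)
  signed-suc {i} {σ} σ≢0 i<n s with x (suc i) ℤ.≟ + 0
  signed-suc σ≢0 i<n (raised Si L) | yes x≡0 =
    raised (trans (cong₂ ℤ._+_ Si x≡0) (ℤ.+-identityʳ _)) (lastNonzero-suc L x≡0)
  signed-suc σ≢0 i<n (lowered Si L) | yes x≡0 =
    lowered (cong₂ ℤ._+_ Si x≡0) (lastNonzero-suc L x≡0)
  signed-suc {i} {σ} σ≢0 i<n (raised Si L) | no x≢0 =
    lowered (trans (cong₂ ℤ._+_ Si x≡-σ) (ℤ.+-inverseʳ σ)) (lastNonzero-here x≡-σ)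
    where x≡-σ = next-nonzero σ≢0 i<n L x≢0
  signed-suc {i} {σ} σ≢0 i<n (lowered Si L) | no x≢0 =
    raised (trans (cong₂ ℤ._+_ Si x≡σ) (ℤ.+-identityˡ σ)) (lastNonzero-here x≡σ)
    where x≡σ = trans (next-nonzero (neg-≢0 σ≢0) i<n L x≢0) (ℤ.neg-involutive σ)

  signed-forward : ∀ {i σ} k → σ ≢ + 0 → Signed σ i → i ≤ k → k ≤ n → Signed σ k
  signed-forward k σ≢0 s i≤k k≤n with ℕ.m≤n⇒m<n∨m≡n i≤k
  ... | inj₂ refl = s
  signed-forward (suc k) σ≢0 s _ k<n | inj₁ (s≤s i≤k) =
    signed-suc σ≢0 k<n (signed-forward k σ≢0 s i≤k (ℕ.<⇒≤ k<n))

  signed-at-end : ∀ {σ} → Signed σ n → σ ≡ + 1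
  signed-at-end (raised Sn _) = trans (sym Sn) (colSums j 1≤j j≤n)
  signed-at-end (lowered Sn _) with trans (sym Sn) (colSums j 1≤j j≤n)
  ... | ()

  Prefix : ℕ → Set
  Prefix i = ZeroUpTo i × S i ≡ + 0 ⊎ ∃ λ σ → σ ≢ + 0 × Signed σ i

  prefix : ∀ i → i ≤ n → Prefix i
  prefix zero _ = inj₁ ((λ l 1≤l l≤0 → ⊥-elim (ℕ.<⇒≱ 1≤l l≤0)) , refl)
  prefix (suc i) i<n with prefix i (ℕ.<⇒≤ i<n) | x (suc i) ℤ.≟ + 0
  ... | inj₁ (zeros , Si) | yes x≡0 = inj₁ (zeroUpTo-suc zeros x≡0 , cong₂ ℤ._+_ Si x≡0)
  ... | inj₁ (zeros , Si) | no x≢0 =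
    inj₂ (x (suc i) , x≢0 , raised (trans (cong (ℤ._+ x (suc i)) Si) (ℤ.+-identityˡ _)) (lastNonzero-here refl))
  ... | inj₂ (σ , σ≢0 , s) | _ = inj₂ (σ , σ≢0 , signed-suc σ≢0 i<n s)

  colPartialSum-bit-alternating : ∀ i → i ≤ n → IsBit (S i)
  colPartialSum-bit-alternating i i≤n with prefix i i≤n
  ... | inj₁ (_ , Si) = inj₁ Si
  ... | inj₂ (σ , σ≢0 , s) with signed-at-end (signed-forward n σ≢0 s i≤n ℕ.≤-refl)
  ... | refl with s
  ...   | raised Si _  = inj₂ Si
  ...   | lowered Si _ = inj₁ Si

asm⇒bitPrefixMatrix : ∀ {n} {A : Matrix n} → IsASM A → IsBitPrefixMatrix A
asm⇒bitPrefixMatrix (entries , rowSums , colSums , _ , colsAlternate) = entries , colPrefixes , rowSums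
  where
    colPrefixes : ColPartialSumsIn01 _
    colPrefixes i j _ i≤n 1≤j j≤n =
      let bit = colPartialSum-bit-alternating colsAlternate colSums 1≤j j≤n i i≤n in 0≤bit bit , bit≤1 bit

tabulateℕ : ∀ {n} → (ℕ → ℕ → ℤ) → Matrix n
tabulateℕ f a b = f (toℕ a) (toℕ b)

entry-tabulateℕ : ∀ {n} f i j → i < n → j < n → entry (tabulateℕ {n} f) (suc i) (suc j) ≡ f i j
entry-tabulateℕ {n} f i j i<n j<n with i <? n | j <? n
... | yes p  | yes q  = cong₂ f (toℕ-fromℕ< p) (toℕ-fromℕ< q)
... | no i≮n | _      = ⊥-elim (i≮n i<n)
... | yes _  | no j≮n = ⊥-elim (j≮n j<n)

rowPrefix-tabulateℕ : ∀ {n} f i k → i < n → k ≤ n → sum1to k (entry (tabulateℕ {n} f) (suc i)) ≡ sumℤ< k (f i)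
rowPrefix-tabulateℕ f i k i<n k≤n =
  trans (sum1to≡sumℤ< k _) (sumℤ<-cong k _ _ (λ j j<k → entry-tabulateℕ f i j i<n (ℕ.<-≤-trans j<k k≤n)))

minusOnesInRow-tabulateℕ : ∀ {n} f i → i < n → minusOnesInRow (tabulateℕ {n} f) (suc i) ≡ sumℕ< n (isMinusOne ∘ f i)
minusOnesInRow-tabulateℕ {n} f i i<n =
  trans (sumℕ1to≡sumℕ< n _) (sumℕ<-cong n _ _ (λ j j<n → cong isMinusOne (entry-tabulateℕ f i j i<n j<n)))

Symmetric : ∀ {n} → Matrix n → Set
Symmetric {n} A = ∀ i j → 1 ≤ i → i ≤ n → 1 ≤ j → j ≤ n → entry A i j ≡ entry A j i

module _ {n} {A : Matrix n} (symmetric : Symmetric A) where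

  colPartialSum-symmetric : ∀ i j → i ≤ n → 1 ≤ j → j ≤ n → colPartialSum A i j ≡ sum1to i (entry A j)
  colPartialSum-symmetric i j i≤n 1≤j j≤n =
    sum1to-cong i _ _ (λ k 1≤k k≤i → symmetric k j 1≤k (ℕ.≤-trans k≤i i≤n) 1≤j j≤n)

  colSumsOne-symmetric : RowSumsOne A → ColSumsOne A
  colSumsOne-symmetric rowSums j 1≤j j≤n =
    trans (colPartialSum-symmetric n j ℕ.≤-refl 1≤j j≤n) (rowSums j 1≤j j≤n)

  colsAlternate-symmetric : RowsAlternate A → ColsAlternate A
  colsAlternate-symmetric rowsAlternate j i k 1≤j j≤n 1≤i i<k k≤n i≢0 k≢0 between =
    trans (symmetric i j 1≤i i≤n 1≤j j≤n)
      (trans (rowsAlternate j i k 1≤j j≤n 1≤i i<k k≤n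
                (λ e → i≢0 (trans (symmetric i j 1≤i i≤n 1≤j j≤n) e))
                (λ e → k≢0 (trans (symmetric k j 1≤k k≤n 1≤j j≤n) e))
                (λ l i<l l<k → trans (symmetric j l 1≤j j≤n (ℕ.≤-trans 1≤i (ℕ.<⇒≤ i<l)) (ℕ.≤-trans (ℕ.<⇒≤ l<k) k≤n))
                                     (between l i<l l<k)))
             (cong -_ (symmetric j k 1≤j j≤n 1≤k k≤n)))
    where
      i≤n = ℕ.≤-trans (ℕ.<⇒≤ i<k) k≤n
      1≤k = ℕ.≤-trans 1≤i (ℕ.<⇒≤ i<k)

zigzag : ℕ → ℕ → ℤ
zigzag zero    zero          = + 1
zigzag zero    (suc _)       = + 0
zigzag (suc t) zero          = + 1
zigzag (suc t) (suc zero)    = - + 1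
zigzag (suc t) (suc (suc k)) = zigzag t k

bandRow : ℕ → ℕ → ℕ → ℤ
bandRow zero    t k       = zigzag t k
bandRow (suc d) t zero    = + 0
bandRow (suc d) t (suc k) = bandRow d t k

bandPrefix : ℕ → ℕ → ℕ → ℤ
bandPrefix d t k = sumℤ< k (bandRow d t)

bandPrefix-shift : ∀ d t k → bandPrefix (suc d) t (suc k) ≡ bandPrefix d t k
bandPrefix-shift d t k = trans (sumℤ<-head k (bandRow (suc d) t)) (ℤ.+-identityˡ _)

zigzagPrefix-zero : ∀ k → bandPrefix 0 0 (suc k) ≡ + 1
zigzagPrefix-zero k = trans (sumℤ<-head k (zigzag 0)) (cong (ℤ._+_ (+ 1)) (sumℤ<-zero k))

zigzagPrefix-suc : ∀ t k → bandPrefix 0 (suc t) (suc (suc k)) ≡ bandPrefix 0 t k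
zigzagPrefix-suc t k = begin
  bandPrefix 0 (suc t) (suc (suc k))              ≡⟨ sumℤ<-head (suc k) (zigzag (suc t)) ⟩
  + 1 ℤ.+ sumℤ< (suc k) (zigzag (suc t) ∘ suc)    ≡⟨ cong (ℤ._+_ (+ 1)) (sumℤ<-head k (zigzag (suc t) ∘ suc)) ⟩
  + 1 ℤ.+ (- + 1 ℤ.+ bandPrefix 0 t k)            ≡⟨ ℤ.+-assoc (+ 1) (- + 1) (bandPrefix 0 t k) ⟨
  + 0 ℤ.+ bandPrefix 0 t k                        ≡⟨ ℤ.+-identityˡ (bandPrefix 0 t k) ⟩
  bandPrefix 0 t k                                ∎
  where open ≡-Reasoning

bandPrefix-bit : ∀ d t k → IsBit (bandPrefix d t k)
bandPrefix-bit d       t       zero          = inj₁ refl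
bandPrefix-bit (suc d) t       (suc k)       = subst IsBit (sym (bandPrefix-shift d t k)) (bandPrefix-bit d t k)
bandPrefix-bit zero    zero    (suc k)       = inj₂ (zigzagPrefix-zero k)
bandPrefix-bit zero    (suc t) (suc zero)    = inj₂ refl
bandPrefix-bit zero    (suc t) (suc (suc k)) = subst IsBit (sym (zigzagPrefix-suc t k)) (bandPrefix-bit zero t k)

bandPrefix-complete : ∀ d t k → d + (t + t) < k → bandPrefix d t k ≡ + 1
bandPrefix-complete (suc d) t       (suc k)       (s≤s <k) =
  trans (bandPrefix-shift d t k) (bandPrefix-complete d t k <k)
bandPrefix-complete zero    zero    (suc k)       _        = zigzagPrefix-zero k
bandPrefix-complete zero    (suc t) (suc (suc k)) (s≤s <k) =
  trans (zigzagPrefix-suc t k) (bandPrefix-complete zero t k (s≤s⁻¹ (subst (_≤ suc k) (ℕ.+-suc (suc t) t) <k)))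
bandPrefix-complete zero    (suc t) (suc zero)    (s≤s ())

bandPrefix-pred : ∀ d t k → bandPrefix d (suc t) k ≡ + 1 → bandPrefix d t k ≡ + 1
bandPrefix-pred d       t       zero          ()
bandPrefix-pred (suc d) t       (suc k)       p =
  trans (bandPrefix-shift d t k) (bandPrefix-pred d t k (trans (sym (bandPrefix-shift d (suc t) k)) p))
bandPrefix-pred zero    zero    (suc k)       _ = zigzagPrefix-zero k
bandPrefix-pred zero    (suc t) (suc zero)    _ = refl
bandPrefix-pred zero    (suc t) (suc (suc k)) p =
  trans (zigzagPrefix-suc t k) (bandPrefix-pred zero t k (trans (sym (zigzagPrefix-suc (suc t) k)) p))

bandPrefix-shrink : ∀ d {t t′} k → t′ ≤ t → bandPrefix d t k ≡ + 1 → bandPrefix d t′ k ≡ + 1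
bandPrefix-shrink d k t′≤t p with ℕ.m≤n⇒m<n∨m≡n t′≤t
... | inj₂ refl = p
bandPrefix-shrink d {suc t} k _ p | inj₁ (s≤s t′≤t) = bandPrefix-shrink d k t′≤t (bandPrefix-pred d t k p)

bandPrefix-grow : ∀ d t k → bandPrefix d t k ≡ + 1 → bandPrefix d (suc t) (suc (suc k)) ≡ + 1
bandPrefix-grow d       t zero    ()
bandPrefix-grow (suc d) t (suc k) p =
  trans (bandPrefix-shift d (suc t) (suc (suc k))) (bandPrefix-grow d t k (trans (sym (bandPrefix-shift d t k)) p))
bandPrefix-grow zero    t (suc k) p = trans (zigzagPrefix-suc t (suc k)) p

bandPrefix-shiftLeft-grow : ∀ d t k → bandPrefix (suc d) t k ≡ + 1 → bandPrefix d (suc t) (suc k) ≡ + 1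
bandPrefix-shiftLeft-grow d t zero    ()
bandPrefix-shiftLeft-grow d t (suc k) p = bandPrefix-grow d t k (trans (sym (bandPrefix-shift d t k)) p)

bandPrefix-shiftRight-shrink : ∀ d {t t′} k → t′ ≤ t → bandPrefix d t k ≡ + 1 →
                               bandPrefix (suc d) t′ (suc k) ≡ + 1
bandPrefix-shiftRight-shrink d k t′≤t p = trans (bandPrefix-shift d _ k) (bandPrefix-shrink d k t′≤t p)

bandRow-minusOnes : ∀ d t k → d + (t + t) < k → sumℕ< k (isMinusOne ∘ bandRow d t) ≡ t
bandRow-minusOnes (suc d) t       (suc k)       (s≤s <k) = trans (sumℕ<-head k _) (bandRow-minusOnes d t k <k)
bandRow-minusOnes zero    zero    (suc k)       _        = trans (sumℕ<-head k _) (sumℕ<-zero k)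
bandRow-minusOnes zero    (suc t) (suc (suc k)) (s≤s <k) =
  trans (sumℕ<-head (suc k) _) (trans (sumℕ<-head k _)
    (cong suc (bandRow-minusOnes zero t k (s≤s⁻¹ (subst (_≤ suc k) (ℕ.+-suc (suc t) t) <k)))))
bandRow-minusOnes zero    (suc t) (suc zero)    (s≤s ())

zigzag-trit : ∀ t k → IsTrit (zigzag t k)
zigzag-trit zero    zero          = inj₂ (inj₁ refl)
zigzag-trit zero    (suc k)       = inj₁ refl
zigzag-trit (suc t) zero          = inj₂ (inj₁ refl)
zigzag-trit (suc t) (suc zero)    = inj₂ (inj₂ refl)
zigzag-trit (suc t) (suc (suc k)) = zigzag-trit t k

bandRow-trit : ∀ d t k → IsTrit (bandRow d t k)
bandRow-trit zero    t k       = zigzag-trit t k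
bandRow-trit (suc d) t zero    = inj₁ refl
bandRow-trit (suc d) t (suc k) = bandRow-trit d t k

altSign : ℕ → ℤ
altSign zero    = + 1
altSign (suc k) = - altSign k

altSign-+-even : ∀ a b → altSign (a + (b + b)) ≡ altSign a
altSign-+-even a zero    = cong altSign (ℕ.+-identityʳ a)
altSign-+-even a (suc b) = begin
  altSign (a + suc (b + suc b))   ≡⟨ cong (λ c → altSign (a + suc c)) (ℕ.+-suc b b) ⟩
  altSign (a + suc (suc (b + b))) ≡⟨ cong altSign (ℕ.+-suc a (suc (b + b))) ⟩
  - altSign (a + suc (b + b))     ≡⟨ cong (-_ ∘ altSign) (ℕ.+-suc a (b + b)) ⟩
  - - altSign (a + (b + b))       ≡⟨ ℤ.neg-involutive _ ⟩
  altSign (a + (b + b))           ≡⟨ altSign-+-even a b ⟩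
  altSign a                       ∎
  where open ≡-Reasoning

altSign-≢0 : ∀ k → altSign k ≢ + 0
altSign-≢0 zero    ()
altSign-≢0 (suc k) e = altSign-≢0 k (trans (sym (ℤ.neg-involutive (altSign k))) (cong -_ e))

InBand : ℕ → ℕ → ℕ → Set
InBand d t k = d ≤ k × k ≤ d + (t + t)

inBand? : ∀ d t k → Dec (InBand d t k)
inBand? d t k = d ≤? k ×-dec k ≤? d + (t + t)

bandRow-inside : ∀ d t k → InBand d t k → bandRow d t k ≡ altSign (k ∸ d)
bandRow-inside (suc d) t       (suc k)       (s≤s d≤k , s≤s k≤) = bandRow-inside d t k (d≤k , k≤)
bandRow-inside zero    zero    zero          _                  = refl
bandRow-inside zero    (suc t) zero          _                  = refl
bandRow-inside zero    (suc t) (suc zero)    _                  = refl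
bandRow-inside zero    (suc t) (suc (suc k)) (_ , s≤s k≤)       =
  trans (bandRow-inside zero t k (z≤n , s≤s⁻¹ (subst (suc k ≤_) (ℕ.+-suc t t) k≤)))
        (sym (ℤ.neg-involutive (altSign k)))

bandRow-before : ∀ d t k → k < d → bandRow d t k ≡ + 0
bandRow-before (suc d) t zero    _         = refl
bandRow-before (suc d) t (suc k) (s≤s k<d) = bandRow-before d t k k<d

bandRow-after : ∀ d t k → d + (t + t) < k → bandRow d t k ≡ + 0
bandRow-after (suc d) t       (suc k)       (s≤s <k) = bandRow-after d t k <k
bandRow-after zero    zero    (suc k)       _        = refl
bandRow-after zero    (suc t) (suc (suc k)) (s≤s <k) =
  bandRow-after zero t k (s≤s⁻¹ (subst (_≤ suc k) (ℕ.+-suc (suc t) t) <k))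
bandRow-after zero    (suc t) (suc zero)    (s≤s ())

bandRow-outside : ∀ d t k → ¬ InBand d t k → bandRow d t k ≡ + 0
bandRow-outside d t k ∉ with d ≤? k | k ≤? d + (t + t)
... | yes d≤k | yes k≤ = ⊥-elim (∉ (d≤k , k≤))
... | no d≰k  | _      = bandRow-before d t k (ℕ.≰⇒> d≰k)
... | yes _   | no k≰  = bandRow-after d t k (ℕ.≰⇒> k≰)

bandRow-nonzero⇒inBand : ∀ d t k → bandRow d t k ≢ + 0 → InBand d t k
bandRow-nonzero⇒inBand d t k ≢0 with inBand? d t k
... | yes ∈ = ∈
... | no ∉  = ⊥-elim (≢0 (bandRow-outside d t k ∉))

bandRow-alternates : ∀ d t j k → j < k → bandRow d t j ≢ + 0 → bandRow d t k ≢ + 0 →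
                     (∀ l → j < l → l < k → bandRow d t l ≡ + 0) → bandRow d t j ≡ - bandRow d t k
bandRow-alternates d t j k j<k j≢0 k≢0 between with ℕ.m≤n⇒m<n∨m≡n j<k
... | inj₂ refl = begin
  bandRow d t j                ≡⟨ bandRow-inside d t j j∈ ⟩
  altSign (j ∸ d)              ≡⟨ ℤ.neg-involutive _ ⟨
  - altSign (suc (j ∸ d))      ≡⟨ cong (-_ ∘ altSign) (ℕ.+-∸-assoc 1 (proj₁ j∈)) ⟨
  - altSign (suc j ∸ d)        ≡⟨ cong -_ (bandRow-inside d t (suc j) (bandRow-nonzero⇒inBand d t k k≢0)) ⟨
  - bandRow d t (suc j)        ∎
  where
    open ≡-Reasoning
    j∈ = bandRow-nonzero⇒inBand d t j j≢0
... | inj₁ 1+j<k = ⊥-elim (altSign-≢0 (suc j ∸ d) (begin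
  altSign (suc j ∸ d) ≡⟨ bandRow-inside d t (suc j) 1+j∈ ⟨
  bandRow d t (suc j) ≡⟨ between (suc j) ℕ.≤-refl 1+j<k ⟩
  + 0                 ∎))
  where
    open ≡-Reasoning
    1+j∈ : InBand d t (suc j)
    1+j∈ = ℕ.m≤n⇒m≤1+n (proj₁ (bandRow-nonzero⇒inBand d t j j≢0)) ,
           ℕ.≤-trans (ℕ.<⇒≤ 1+j<k) (proj₂ (bandRow-nonzero⇒inBand d t k k≢0))

-- The diamond

rowOffset : ℕ → ℕ → ℕ
rowOffset Q i = ∣ Q - i ∣

rowRank : ℕ → ℕ → ℕ → ℕ
rowRank Q P i = i ⊓ (P + Q ∸ i)

data RowShape (Q P i : ℕ) : Set where
  upper : ∀ e → Q ≡ i + e → rowOffset Q i ≡ e → rowRank Q P i ≡ i → RowShape Q P i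
  lower : ∀ u t → i ≡ suc (Q + u) → P ≡ suc (u + t) → rowOffset Q i ≡ suc u → rowRank Q P i ≡ t →
          RowShape Q P i

rowShape : ∀ Q P i → Q ≤ P → P ≤ suc Q → i ≤ P + Q → RowShape Q P i
rowShape Q P i Q≤P P≤1+Q i≤m with i ≤? Q
... | yes i≤Q = upper (Q ∸ i) (sym (ℕ.m+[n∸m]≡n i≤Q)) (ℕ.m≤n⇒∣n-m∣≡n∸m i≤Q) (ℕ.m≤n⇒m⊓n≡m i≤m∸i)
  where
    i≤m∸i : i ≤ P + Q ∸ i
    i≤m∸i = ℕ.m+n≤o⇒m≤o∸n i (ℕ.+-mono-≤ (ℕ.≤-trans i≤Q Q≤P) i≤Q)
rowShape Q P zero    Q≤P P≤1+Q i≤m | no 0≰Q = ⊥-elim (0≰Q z≤n)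
rowShape Q P (suc i) Q≤P P≤1+Q i<m | no i≰Q = lower u t i≡ P≡ offset rank
  where
    Q≤i : Q ≤ i
    Q≤i = s≤s⁻¹ (ℕ.≰⇒> i≰Q)
    u = i ∸ Q
    t = P + Q ∸ suc i
    i≡ : suc i ≡ suc (Q + u)
    i≡ = cong suc (sym (ℕ.m+[n∸m]≡n Q≤i))
    P≡ : P ≡ suc (u + t)
    P≡ = ℕ.+-cancelʳ-≡ Q P (suc (u + t)) (begin
      P + Q               ≡⟨ ℕ.m+[n∸m]≡n i<m ⟨
      suc i + t           ≡⟨ cong (_+ t) i≡ ⟩
      suc (Q + u) + t     ≡⟨ rearrange Q u t ⟩
      suc (u + t) + Q     ∎)
      where
        open ≡-Reasoning
        rearrange : ∀ Q u t → suc (Q + u) + t ≡ suc (u + t) + Q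
        rearrange = ℕ-solve-∀
    offset : rowOffset Q (suc i) ≡ suc u
    offset = trans (ℕ.m≤n⇒∣m-n∣≡n∸m (ℕ.m≤n⇒m≤1+n Q≤i)) (ℕ.+-∸-assoc 1 Q≤i)
    t≤Q : t ≤ Q
    t≤Q = ℕ.≤-trans (ℕ.m≤n+m t u) (s≤s⁻¹ (subst (_≤ suc Q) P≡ P≤1+Q))
    rank : rowRank Q P (suc i) ≡ t
    rank = ℕ.m≥n⇒m⊓n≡n (ℕ.≤-trans t≤Q (ℕ.m≤n⇒m≤1+n Q≤i))

row-fits : ∀ Q P i → Q ≤ P → P ≤ suc Q → i ≤ P + Q → rowOffset Q i + (rowRank Q P i + rowRank Q P i) ≤ P + Q
row-fits Q P i Q≤P P≤1+Q i≤m with rowShape Q P i Q≤P P≤1+Q i≤m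
... | upper e Q≡ offset rank = begin
  rowOffset Q i + (rowRank Q P i + rowRank Q P i) ≡⟨ cong₂ (λ a b → a + (b + b)) offset rank ⟩
  e + (i + i)                                     ≡⟨ rearrange e i ⟩
  (i + e) + i                                     ≡⟨ cong (_+ i) Q≡ ⟨
  Q + i                                           ≤⟨ ℕ.+-monoʳ-≤ Q i≤P ⟩
  Q + P                                           ≡⟨ ℕ.+-comm Q P ⟩
  P + Q                                           ∎
  where
    open ℕ.≤-Reasoning
    i≤P : i ≤ P
    i≤P = ℕ.≤-trans (ℕ.m≤m+n i e) (subst (_≤ P) Q≡ Q≤P)
    rearrange : ∀ e i → e + (i + i) ≡ (i + e) + i
    rearrange = ℕ-solve-∀
... | lower u t _ P≡ offset rank = begin
  rowOffset Q i + (rowRank Q P i + rowRank Q P i) ≡⟨ cong₂ (λ a b → a + (b + b)) offset rank ⟩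
  suc u + (t + t)                                 ≡⟨ cong suc (ℕ.+-assoc u t t) ⟨
  suc (u + t) + t                                 ≡⟨ cong (_+ t) P≡ ⟨
  P + t                                           ≤⟨ ℕ.+-monoʳ-≤ P t≤Q ⟩
  P + Q                                           ∎
  where
    open ℕ.≤-Reasoning
    t≤Q : t ≤ Q
    t≤Q = ℕ.≤-trans (ℕ.m≤n+m t u) (s≤s⁻¹ (subst (_≤ suc Q) P≡ P≤1+Q))

-- The union of the row bands, described symmetrically in i and j; on it the sign of entry
-- (i, j) is (-1)^(i + j + Q).
InDiamond : ℕ → ℕ → ℕ → ℕ → Set
InDiamond Q P i j = Q ≤ i + j × i + j ≤ P + P + Q × i ≤ j + Q × j ≤ i + Q

InDiamond-sym : ∀ {Q P i j} → InDiamond Q P i j → InDiamond Q P j i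
InDiamond-sym {Q} {P} {i} {j} (lo , hi , i≤ , j≤) =
  subst (Q ≤_) (ℕ.+-comm i j) lo , subst (_≤ P + P + Q) (ℕ.+-comm i j) hi , j≤ , i≤

InRowBand : ℕ → ℕ → ℕ → ℕ → Set
InRowBand Q P i j = InBand (rowOffset Q i) (rowRank Q P i) j

inRowBand⇒inDiamond : ∀ Q P i j → Q ≤ P → P ≤ suc Q → i ≤ P + Q → InRowBand Q P i j → InDiamond Q P i j
inRowBand⇒inDiamond Q P i j Q≤P P≤1+Q i≤m (off≤j , j≤) with rowShape Q P i Q≤P P≤1+Q i≤m
inRowBand⇒inDiamond .(i + e) P i j Q≤P P≤1+Q i≤m (off≤j , j≤) | upper e refl offset rank =
  ℕ.+-monoʳ-≤ i e≤j ,
  ℕ.≤-trans (ℕ.+-monoʳ-≤ i j≤′)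
    (ℕ.≤-trans (ℕ.≤-reflexive (rearrange i e)) (ℕ.+-monoˡ-≤ (i + e) (ℕ.+-mono-≤ i≤P i≤P))) ,
  ℕ.≤-trans (ℕ.m≤m+n i e) (ℕ.m≤n+m (i + e) j) ,
  ℕ.≤-trans j≤′ (ℕ.≤-reflexive (rearrange′ i e))
  where
    e≤j : e ≤ j
    e≤j = subst (_≤ j) offset off≤j
    j≤′ : j ≤ e + (i + i)
    j≤′ = subst₂ (λ a b → j ≤ a + (b + b)) offset rank j≤
    i≤P : i ≤ P
    i≤P = ℕ.≤-trans (ℕ.m≤m+n i e) Q≤P
    rearrange : ∀ i e → i + (e + (i + i)) ≡ (i + i) + (i + e)
    rearrange = ℕ-solve-∀
    rearrange′ : ∀ i e → e + (i + i) ≡ i + (i + e)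
    rearrange′ = ℕ-solve-∀
inRowBand⇒inDiamond Q .(suc (u + t)) .(suc (Q + u)) j Q≤P P≤1+Q i≤m (off≤j , j≤) | lower u t refl refl offset rank =
  ℕ.≤-trans (ℕ.m≤m+n Q u) (ℕ.≤-trans (ℕ.n≤1+n (Q + u)) (ℕ.m≤m+n (suc (Q + u)) j)) ,
  ℕ.≤-trans (ℕ.+-monoʳ-≤ (suc (Q + u)) j≤′) (ℕ.≤-reflexive (rearrange Q u t)) ,
  subst (_≤ j + Q) (sym (rearrange′ Q u)) (ℕ.+-monoˡ-≤ Q 1+u≤j) ,
  ℕ.≤-trans j≤′ (ℕ.≤-trans (ℕ.+-monoʳ-≤ (suc u) (ℕ.+-mono-≤ t≤Q t≤Q)) (ℕ.≤-reflexive (rearrange″ Q u)))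
  where
    1+u≤j : suc u ≤ j
    1+u≤j = subst (_≤ j) offset off≤j
    j≤′ : j ≤ suc u + (t + t)
    j≤′ = subst₂ (λ a b → j ≤ a + (b + b)) offset rank j≤
    t≤Q : t ≤ Q
    t≤Q = ℕ.≤-trans (ℕ.m≤n+m t u) (s≤s⁻¹ P≤1+Q)
    rearrange : ∀ Q u t → suc (Q + u) + (suc u + (t + t)) ≡ suc (u + t) + suc (u + t) + Q
    rearrange = ℕ-solve-∀
    rearrange′ : ∀ Q u → suc (Q + u) ≡ suc u + Q
    rearrange′ = ℕ-solve-∀
    rearrange″ : ∀ Q u → suc u + (Q + Q) ≡ suc (Q + u) + Q
    rearrange″ = ℕ-solve-∀

inDiamond⇒inRowBand : ∀ Q P i j → Q ≤ P → P ≤ suc Q → i ≤ P + Q → InDiamond Q P i j → InRowBand Q P i j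
inDiamond⇒inRowBand Q P i j Q≤P P≤1+Q i≤m (lo , hi , i≤ , j≤) with rowShape Q P i Q≤P P≤1+Q i≤m
inDiamond⇒inRowBand .(i + e) P i j Q≤P P≤1+Q i≤m (lo , hi , i≤ , j≤) | upper e refl offset rank =
  subst (_≤ j) (sym offset) (ℕ.+-cancelˡ-≤ i e j lo) ,
  subst₂ (λ a b → j ≤ a + (b + b)) (sym offset) (sym rank) (ℕ.≤-trans j≤ (ℕ.≤-reflexive (rearrange i e)))
  where
    rearrange : ∀ i e → i + (i + e) ≡ e + (i + i)
    rearrange = ℕ-solve-∀
inDiamond⇒inRowBand Q .(suc (u + t)) .(suc (Q + u)) j Q≤P P≤1+Q i≤m (lo , hi , i≤ , j≤) | lower u t refl refl offset rank =
  subst (_≤ j) (sym offset) (ℕ.+-cancelʳ-≤ Q (suc u) j (subst (_≤ j + Q) (rearrange Q u) i≤)) ,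
  subst₂ (λ a b → j ≤ a + (b + b)) (sym offset) (sym rank)
    (ℕ.+-cancelˡ-≤ (suc (Q + u)) j (suc u + (t + t)) (ℕ.≤-trans hi (ℕ.≤-reflexive (rearrange′ Q u t))))
  where
    rearrange : ∀ Q u → suc (Q + u) ≡ suc u + Q
    rearrange = ℕ-solve-∀
    rearrange′ : ∀ Q u t → suc (u + t) + suc (u + t) + Q ≡ suc (Q + u) + (suc u + (t + t))
    rearrange′ = ℕ-solve-∀

rowBand-sign : ∀ Q P i j → Q ≤ P → P ≤ suc Q → i ≤ P + Q → InRowBand Q P i j →
               altSign (j ∸ rowOffset Q i) ≡ altSign (i + j + Q)
rowBand-sign Q P i j Q≤P P≤1+Q i≤m (off≤j , _) with rowShape Q P i Q≤P P≤1+Q i≤m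
rowBand-sign .(i + e) P i j Q≤P P≤1+Q i≤m (off≤j , _) | upper e refl offset rank = begin
  altSign (j ∸ rowOffset (i + e) i)               ≡⟨ cong (λ o → altSign (j ∸ o)) offset ⟩
  altSign (j ∸ e)                                 ≡⟨ altSign-+-even (j ∸ e) (i + e) ⟨
  altSign ((j ∸ e) + ((i + e) + (i + e)))         ≡⟨ cong altSign (rearrange i e (j ∸ e)) ⟨
  altSign (i + (e + (j ∸ e)) + (i + e))           ≡⟨ cong (λ k → altSign (i + k + (i + e))) (ℕ.m+[n∸m]≡n e≤j) ⟩
  altSign (i + j + (i + e))                       ∎
  where
    open ≡-Reasoning
    e≤j = subst (_≤ j) offset off≤j
    rearrange : ∀ i e w → i + (e + w) + (i + e) ≡ w + ((i + e) + (i + e))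
    rearrange = ℕ-solve-∀
rowBand-sign Q P .(suc (Q + u)) j Q≤P P≤1+Q i≤m (off≤j , _) | lower u t refl refl offset rank = begin
  altSign (j ∸ rowOffset Q (suc (Q + u)))                      ≡⟨ cong (λ o → altSign (j ∸ o)) offset ⟩
  altSign (j ∸ suc u)                                          ≡⟨ altSign-+-even (j ∸ suc u) (suc (Q + u)) ⟨
  altSign ((j ∸ suc u) + (suc (Q + u) + suc (Q + u)))          ≡⟨ cong altSign (rearrange Q u (j ∸ suc u)) ⟨
  altSign (suc (Q + u) + (suc u + (j ∸ suc u)) + Q)
    ≡⟨ cong (λ k → altSign (suc (Q + u) + k + Q)) (ℕ.m+[n∸m]≡n 1+u≤j) ⟩
  altSign (suc (Q + u) + j + Q)                                ∎
  where
    open ≡-Reasoning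
    1+u≤j = subst (_≤ j) offset off≤j
    rearrange : ∀ Q u w → suc (Q + u) + (suc u + w) + Q ≡ w + (suc (Q + u) + suc (Q + u))
    rearrange = ℕ-solve-∀

diamondEntry : ℕ → ℕ → ℕ → ℕ → ℤ
diamondEntry Q P i = bandRow (rowOffset Q i) (rowRank Q P i)

diamondEntry-sym : ∀ Q P i j → Q ≤ P → P ≤ suc Q → i ≤ P + Q → j ≤ P + Q →
                   diamondEntry Q P i j ≡ diamondEntry Q P j i
diamondEntry-sym Q P i j Q≤P P≤1+Q i≤m j≤m
  with inBand? (rowOffset Q i) (rowRank Q P i) j | inBand? (rowOffset Q j) (rowRank Q P j) i
... | yes ij∈ | yes ji∈ = begin
  diamondEntry Q P i j        ≡⟨ bandRow-inside _ _ j ij∈ ⟩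
  altSign (j ∸ rowOffset Q i) ≡⟨ rowBand-sign Q P i j Q≤P P≤1+Q i≤m ij∈ ⟩
  altSign (i + j + Q)         ≡⟨ cong (λ k → altSign (k + Q)) (ℕ.+-comm i j) ⟩
  altSign (j + i + Q)         ≡⟨ rowBand-sign Q P j i Q≤P P≤1+Q j≤m ji∈ ⟨
  altSign (i ∸ rowOffset Q j) ≡⟨ bandRow-inside _ _ i ji∈ ⟨
  diamondEntry Q P j i        ∎
  where open ≡-Reasoning
... | yes ij∈ | no ji∉ = ⊥-elim (ji∉ (inDiamond⇒inRowBand Q P j i Q≤P P≤1+Q j≤m
                                       (InDiamond-sym {Q} {P} (inRowBand⇒inDiamond Q P i j Q≤P P≤1+Q i≤m ij∈))))
... | no ij∉ | yes ji∈ = ⊥-elim (ij∉ (inDiamond⇒inRowBand Q P i j Q≤P P≤1+Q i≤m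
                                       (InDiamond-sym {Q} {P} (inRowBand⇒inDiamond Q P j i Q≤P P≤1+Q j≤m ji∈))))
... | no ij∉ | no ji∉ = trans (bandRow-outside _ _ j ij∉) (sym (bandRow-outside _ _ i ji∉))

bandPrefix≡1-cong : ∀ {d d′ r r′} k → d ≡ d′ → r ≡ r′ → bandPrefix d r k ≡ + 1 → bandPrefix d′ r′ k ≡ + 1
bandPrefix≡1-cong k refl refl p = p

-- The magog inequality in the only case where the subtracted partial sum is 1 (by symmetry,
-- column partial sums are row prefixes).
rowPrefix-suc : ∀ Q P i k → Q ≤ P → P ≤ suc Q → suc i ≤ P + Q →
                bandPrefix (rowOffset Q i) (rowRank Q P i) k ≡ + 1 →
                bandPrefix (rowOffset Q (suc i)) (rowRank Q P (suc i)) (suc k) ≡ + 1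
rowPrefix-suc Q P i k Q≤P P≤1+Q i<m p
  with rowShape Q P i Q≤P P≤1+Q (ℕ.<⇒≤ i<m) | rowShape Q P (suc i) Q≤P P≤1+Q i<m
... | upper e Q≡ offset rank | upper e′ Q≡′ offset′ rank′ =
  bandPrefix≡1-cong (suc k) (sym offset′) (sym rank′)
    (bandPrefix-shiftLeft-grow e′ i k (bandPrefix≡1-cong k (trans offset e≡) rank p))
  where
    e≡ : e ≡ suc e′
    e≡ = ℕ.+-cancelˡ-≡ i e (suc e′) (trans (sym Q≡) (trans Q≡′ (sym (ℕ.+-suc i e′))))
... | upper e Q≡ offset rank | lower u′ t′ i≡′ P≡′ offset′ rank′ =
  bandPrefix≡1-cong (suc k) (sym (trans offset′ (cong suc u′≡0))) (sym rank′)
    (bandPrefix-shiftRight-shrink 0 k t′≤i (bandPrefix≡1-cong k (trans offset e≡0) rank p))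
  where
    e+u′≡0 : e + u′ ≡ 0
    e+u′≡0 = ℕ.+-cancelˡ-≡ i (e + u′) 0 (begin
      i + (e + u′) ≡⟨ ℕ.+-assoc i e u′ ⟨
      i + e + u′   ≡⟨ cong (_+ u′) Q≡ ⟨
      Q + u′       ≡⟨ ℕ.suc-injective i≡′ ⟨
      i            ≡⟨ ℕ.+-identityʳ i ⟨
      i + 0        ∎)
      where open ≡-Reasoning
    e≡0 = ℕ.m+n≡0⇒m≡0 e e+u′≡0
    u′≡0 = ℕ.m+n≡0⇒n≡0 e e+u′≡0
    t′≤i : t′ ≤ i
    t′≤i = ℕ.≤-trans (ℕ.m≤n+m t′ u′) (ℕ.≤-trans (s≤s⁻¹ (subst (_≤ suc Q) P≡′ P≤1+Q))
                     (ℕ.≤-trans (ℕ.m≤m+n Q u′) (ℕ.≤-reflexive (ℕ.suc-injective (sym i≡′)))))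
... | lower u t i≡ _ _ _ | upper e′ Q≡′ _ _ =
  ⊥-elim (ℕ.<-irrefl refl (begin-strict
    Q             ≤⟨ ℕ.m≤m+n Q u ⟩
    Q + u         <⟨ ℕ.n<1+n (Q + u) ⟩
    suc (Q + u)   ≡⟨ i≡ ⟨
    i             <⟨ ℕ.n<1+n i ⟩
    suc i         ≤⟨ ℕ.m≤m+n (suc i) e′ ⟩
    suc i + e′    ≡⟨ Q≡′ ⟨
    Q             ∎))
  where open ℕ.≤-Reasoning
... | lower u t i≡ P≡ offset rank | lower u′ t′ i≡′ P≡′ offset′ rank′ =
  bandPrefix≡1-cong (suc k) (sym (trans offset′ (cong suc u′≡))) (sym rank′)
    (bandPrefix-shiftRight-shrink (suc u) k t′≤t (bandPrefix≡1-cong k offset rank p))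
  where
    u′≡ : u′ ≡ suc u
    u′≡ = ℕ.+-cancelˡ-≡ Q u′ (suc u) (trans (sym (ℕ.suc-injective i≡′)) (trans i≡ (sym (ℕ.+-suc Q u))))
    t≡ : t ≡ suc t′
    t≡ = ℕ.+-cancelˡ-≡ u t (suc t′)
           (trans (ℕ.suc-injective (trans (sym P≡) P≡′)) (trans (cong (_+ t′) u′≡) (sym (ℕ.+-suc u t′))))
    t′≤t : t′ ≤ t
    t′≤t = subst (t′ ≤_) (sym t≡) (ℕ.n≤1+n t′)

sum-rowRank : ∀ Q P → Q ≤ P → P ≤ suc Q → sumℕ< (suc (P + Q)) (rowRank Q P) ≡ Q * P
sum-rowRank zero    zero          _         _           = refl
sum-rowRank zero    (suc zero)    _         _           = refl
sum-rowRank zero    (suc (suc P)) _         (s≤s ())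
sum-rowRank (suc Q) zero          ()        _
sum-rowRank (suc Q) (suc P)       (s≤s Q≤P) (s≤s P≤1+Q) = begin
  sumℕ< (suc (suc P + suc Q)) (rowRank (suc Q) (suc P))
    ≡⟨ sumℕ<-head (suc P + suc Q) (rowRank (suc Q) (suc P)) ⟩
  sumℕ< (suc (P + suc Q)) (rowRank (suc Q) (suc P) ∘ suc)
    ≡⟨ cong (λ k → sumℕ< (suc k) (rowRank (suc Q) (suc P) ∘ suc)) (ℕ.+-suc P Q) ⟩
  sumℕ< (suc (P + Q)) (rowRank (suc Q) (suc P) ∘ suc) + rowRank (suc Q) (suc P) (suc (suc (P + Q)))
    ≡⟨ cong₂ _+_ (sumℕ<-cong (suc (P + Q)) _ _ inner) last ⟩
  sumℕ< (suc (P + Q)) (suc ∘ rowRank Q P) + 0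
    ≡⟨ ℕ.+-identityʳ _ ⟩
  sumℕ< (suc (P + Q)) (suc ∘ rowRank Q P)
    ≡⟨ sumℕ<-suc (suc (P + Q)) (rowRank Q P) ⟩
  sumℕ< (suc (P + Q)) (rowRank Q P) + suc (P + Q)
    ≡⟨ cong (_+ suc (P + Q)) (sum-rowRank Q P Q≤P P≤1+Q) ⟩
  Q * P + suc (P + Q)
    ≡⟨ expand Q P ⟩
  suc Q * suc P
    ∎
  where
    open ≡-Reasoning
    inner : ∀ i → i < suc (P + Q) → rowRank (suc Q) (suc P) (suc i) ≡ suc (rowRank Q P i)
    inner i (s≤s i≤m) = cong (suc i ⊓_) (trans (cong (_∸ i) (ℕ.+-suc P Q)) (ℕ.+-∸-assoc 1 i≤m))
    last : rowRank (suc Q) (suc P) (suc (suc (P + Q))) ≡ 0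
    last = trans (cong (suc (suc (P + Q)) ⊓_)
                       (trans (cong (_∸ suc (P + Q)) (ℕ.+-suc P Q)) (ℕ.n∸n≡0 (suc (P + Q)))))
                 (ℕ.⊓-zeroʳ (suc (suc (P + Q))))
    expand : ∀ Q P → Q * P + suc (P + Q) ≡ suc Q * suc P
    expand = ℕ-solve-∀

-- The extremal matrix

module Diamond (Q P : ℕ) (Q≤P : Q ≤ P) (P≤1+Q : P ≤ suc Q) where

  diamond : Matrix (suc (P + Q))
  diamond = tabulateℕ (diamondEntry Q P)

  row-fits< : ∀ {i} → i ≤ P + Q → rowOffset Q i + (rowRank Q P i + rowRank Q P i) < suc (P + Q)
  row-fits< {i} i≤m = s≤s (row-fits Q P i Q≤P P≤1+Q i≤m)

  rowPrefix : ℕ → ℕ → ℤ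
  rowPrefix i = bandPrefix (rowOffset Q i) (rowRank Q P i)

  rowPrefix-bit : ∀ i k → IsBit (rowPrefix i k)
  rowPrefix-bit i = bandPrefix-bit (rowOffset Q i) (rowRank Q P i)

  diamond-rowPrefix : ∀ i k → i ≤ P + Q → k ≤ suc (P + Q) → sum1to k (entry diamond (suc i)) ≡ rowPrefix i k
  diamond-rowPrefix i k i≤m = rowPrefix-tabulateℕ (diamondEntry Q P) i k (s≤s i≤m)

  diamond-symmetric : Symmetric diamond
  diamond-symmetric (suc i) (suc j) _ (s≤s i≤m) _ (s≤s j≤m) =
    trans (entry-tabulateℕ _ i j (s≤s i≤m) (s≤s j≤m))
      (trans (diamondEntry-sym Q P i j Q≤P P≤1+Q i≤m j≤m) (sym (entry-tabulateℕ _ j i (s≤s j≤m) (s≤s i≤m))))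

  diamond-colPartialSum : ∀ i j → i ≤ suc (P + Q) → j ≤ P + Q →
                          colPartialSum diamond i (suc j) ≡ rowPrefix j i
  diamond-colPartialSum i j i≤n j≤m =
    trans (colPartialSum-symmetric diamond-symmetric i (suc j) i≤n (s≤s z≤n) (s≤s j≤m)) (diamond-rowPrefix j i j≤m i≤n)

  diamond-entries : Entries01-1 diamond
  diamond-entries a b = bandRow-trit (rowOffset Q (toℕ a)) (rowRank Q P (toℕ a)) (toℕ b)

  diamond-rowSums : RowSumsOne diamond
  diamond-rowSums (suc i) _ (s≤s i≤m) =
    trans (diamond-rowPrefix i (suc (P + Q)) i≤m ℕ.≤-refl)
          (bandPrefix-complete (rowOffset Q i) (rowRank Q P i) (suc (P + Q)) (row-fits< i≤m))

  diamond-rowsAlternate : RowsAlternate diamond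
  diamond-rowsAlternate (suc i) (suc j) (suc k) _ (s≤s i≤m) _ (s≤s j<k) (s≤s k≤m) j≢0 k≢0 between =
    trans (at j j≤m)
      (trans (bandRow-alternates (rowOffset Q i) (rowRank Q P i) j k j<k
                (λ e → j≢0 (trans (at j j≤m) e)) (λ e → k≢0 (trans (at k k≤m) e))
                (λ l j<l l<k → trans (sym (at l (ℕ.≤-trans (ℕ.<⇒≤ l<k) k≤m)))
                                     (between (suc l) (s≤s j<l) (s≤s l<k))))
             (cong -_ (sym (at k k≤m))))
    where
      j≤m = ℕ.≤-trans (ℕ.<⇒≤ j<k) k≤m
      at : ∀ l → l ≤ P + Q → entry diamond (suc i) (suc l) ≡ diamondEntry Q P i l
      at l l≤m = entry-tabulateℕ _ i l (s≤s i≤m) (s≤s l≤m)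

  diamond-isASM : IsASM diamond
  diamond-isASM = diamond-entries , diamond-rowSums , colSumsOne-symmetric diamond-symmetric diamond-rowSums ,
                  diamond-rowsAlternate , colsAlternate-symmetric diamond-symmetric diamond-rowsAlternate

  diamond-isMagog : IsMagog diamond
  diamond-isMagog = diamond-entries , diamond-rowSums , colSumsOne-symmetric diamond-symmetric diamond-rowSums ,
                    colPartialSums , rowPartialSums≥0 , magogInequality
    where
      colPartialSums : ColPartialSumsIn01 diamond
      colPartialSums i (suc j) _ i≤n _ (s≤s j≤m) =
        subst (λ s → s ℤ.≥ + 0 × + 1 ℤ.≥ s) (sym (diamond-colPartialSum i j i≤n j≤m)) (0≤bit bit , bit≤1 bit)
        where bit = rowPrefix-bit j i
      rowPartialSums≥0 : ∀ i j → 1 ≤ i → i ≤ suc (P + Q) → 1 ≤ j → j ≤ suc (P + Q) →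
                         sum1to j (entry diamond i) ℤ.≥ + 0
      rowPartialSums≥0 (suc i) j _ (s≤s i≤m) _ j≤n =
        subst (ℤ._≥ + 0) (sym (diamond-rowPrefix i j i≤m j≤n)) (0≤bit (rowPrefix-bit i j))
      magogInequality : ∀ i j → 1 ≤ i → i ≤ suc (P + Q) ∸ 2 → 1 ≤ j → j ≤ suc (P + Q) ∸ 2 →
                        sum1to j (entry diamond (suc i)) ℤ.+ colPartialSum diamond (suc i) (suc j)
                          ℤ.- colPartialSum diamond i j ℤ.≥ + 0
      magogInequality (suc i) (suc j) _ i≤ _ j≤ =
        subst (ℤ._≥ + 0) (sym (cong₂ ℤ._-_ (cong₂ ℤ._+_ a≡ b≡) c≡))
          (magogCombination≥0 (rowPrefix-bit (suc i) (suc j)) (rowPrefix-bit (suc j) (suc (suc i)))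
                              (rowPrefix-bit j (suc i)) (rowPrefix-suc Q P j (suc i) Q≤P P≤1+Q 1+j≤m))
        where
          pred-suc≤ : ∀ k m → suc k ≤ m ∸ 1 → suc (suc k) ≤ m
          pred-suc≤ k (suc m) k<m = s≤s k<m
          1+i≤m = ℕ.<⇒≤ (pred-suc≤ i (P + Q) i≤)
          1+j≤m = ℕ.<⇒≤ (pred-suc≤ j (P + Q) j≤)
          j≤m = ℕ.<⇒≤ 1+j≤m
          a≡ = diamond-rowPrefix (suc i) (suc j) 1+i≤m (s≤s j≤m)
          b≡ = diamond-colPartialSum (suc (suc i)) (suc j) (s≤s 1+i≤m) 1+j≤m
          c≡ = diamond-colPartialSum (suc i) j (s≤s (ℕ.<⇒≤ 1+i≤m)) j≤m

  negCount-diamond : negCount diamond ≡ Q * P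
  negCount-diamond =
    trans (sumℕ1to≡sumℕ< (suc (P + Q)) _)
      (trans (sumℕ<-cong (suc (P + Q)) _ _ row) (sum-rowRank Q P Q≤P P≤1+Q))
    where
      row : ∀ i → i < suc (P + Q) → minusOnesInRow diamond (suc i) ≡ rowRank Q P i
      row i (s≤s i≤m) = trans (minusOnesInRow-tabulateℕ (diamondEntry Q P) i (s≤s i≤m))
                                (bandRow-minusOnes (rowOffset Q i) (rowRank Q P i) (suc (P + Q)) (row-fits< i≤m))

  sum-rowBounds : sumℕ1to (suc (P + Q)) (λ i → (i ∸ 1) ⊓ (suc (P + Q) ∸ i)) ≡ Q * P
  sum-rowBounds = trans (sumℕ1to≡sumℕ< (suc (P + Q)) _) (sum-rowRank Q P Q≤P P≤1+Q)

  isMaxNegCount-diamond : {IsX : Matrix (suc (P + Q)) → Set} → (∀ {A} → IsX A → IsBitPrefixMatrix A) →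
                          IsX diamond → IsMaxNegCount (suc (P + Q)) IsX (Q * P)
  isMaxNegCount-diamond bitPrefix isX =
    (diamond , isX , negCount-diamond) ,
    λ A x → let (entries , colPrefixes , rowSums) = bitPrefix x
            in ℕ.≤-trans (negCount≤ entries colPrefixes rowSums) (ℕ.≤-reflexive sum-rowBounds)

⌈n/2⌉≤1+⌊n/2⌋ : ∀ n → ⌈ n /2⌉ ≤ suc ⌊ n /2⌋
⌈n/2⌉≤1+⌊n/2⌋ zero          = z≤n
⌈n/2⌉≤1+⌊n/2⌋ (suc zero)    = s≤s z≤n
⌈n/2⌉≤1+⌊n/2⌋ (suc (suc n)) = s≤s (⌈n/2⌉≤1+⌊n/2⌋ n)

corollary3p8 : (n : ℕ) → 1 ≤ n →
    IsMaxNegCount n IsASM (⌊ n ∸ 1 /2⌋ * ⌈ n ∸ 1 /2⌉)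
      × IsMaxNegCount n IsMagog (⌊ n ∸ 1 /2⌋ * ⌈ n ∸ 1 /2⌉)
corollary3p8 (suc m) _ =
  subst (λ k → IsMaxNegCount (suc k) IsASM (Q * P) × IsMaxNegCount (suc k) IsMagog (Q * P)) P+Q≡m
    (isMaxNegCount-diamond asm⇒bitPrefixMatrix diamond-isASM ,
     isMaxNegCount-diamond magog⇒bitPrefixMatrix diamond-isMagog)
  where
    Q = ⌊ m /2⌋
    P = ⌈ m /2⌉
    P+Q≡m : P + Q ≡ m
    P+Q≡m = trans (ℕ.+-comm P Q) (ℕ.⌊n/2⌋+⌈n/2⌉≡n m)
    open Diamond Q P (ℕ.⌊n/2⌋≤⌈n/2⌉ m) (⌈n/2⌉≤1+⌊n/2⌋ m)
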